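{- Let $\sigma^{(n)}=2\,1\,4\,3\,6\,5\cdots 2n\ (2n-1)\in S_{2n}$ (one-line notation). Then for every partition $\lambda$ of $n$, $a_{\sigma^{(n)},\lambda}=f^{\lambda}$.
   Context: A reduced word for $w\in S_m$ is a sequence $(i_1,\dots,i_\ell)$ with $w=s_{i_1}\cdots s_{i_\ell}$, $s_i=(i,i+1)$, $\ell$ the number of inversions of $w$. For a partition $\lambda$, $a_{w,\lambda}$ is the number of fillings of the Young diagram of $\lambda$ by positive integers, strictly increasing along rows and down columns, whose column reading word (entries read top to bottom in each column, columns taken right to left) is a reduced word for $w$. $f^\lambda$ is the number of standard Young tableaux of shape $\lambda$. -}

module Defs where

open import Data.Nat using (ℕ; zero; suc; _+_; _*_; _∸_; _≤_; _<_; _≥_; _⊔_; _≤?_; _<?_; _≟_)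

open import Data.List using (List; []; _∷_; length; map; foldl; foldr; concatMap; reverse; upTo; filter; applyUpTo)
open import Data.Nat.ListAction using (sum)
import Data.List.Properties as LP
open import Data.List.Relation.Unary.All using (All; all?)
open import Data.List.Relation.Unary.Linked using (Linked; linked?)
open import Data.List.Membership.DecPropositional _≟_ using (_∈_; _∈?_)
open import Data.Product using (_×_)
open import Relation.Binary.PropositionalEquality using (_≡_)
open import Relation.Nullary using (Dec)
open import Relation.Nullary.Decidable using (_×-dec_)

-- Permutations of S_m in one-line notation: a list [w(1), …, w(m)].

idPerm : ℕ → List ℕ
idPerm m = applyUpTo suc m

-- swap positions i and i+1 (1-indexed) of a list; this is right
-- multiplication  w ↦ w · s_i  in one-line notation.
swapAt : ℕ → List ℕ → List ℕ
swapAt zero xs = xs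
swapAt (suc zero) (a ∷ b ∷ xs) = b ∷ a ∷ xs
swapAt (suc zero) xs = xs
swapAt (suc (suc i)) [] = []
swapAt (suc (suc i)) (a ∷ xs) = a ∷ swapAt (suc i) xs

wordPerm : ℕ → List ℕ → List ℕ
wordPerm m word = foldl (λ w i → swapAt i w) (idPerm m) word

inversions : List ℕ → ℕ
inversions [] = 0
inversions (x ∷ xs) = length (filter (λ y → y <? x) xs) + inversions xs

IsReducedWord : List ℕ → List ℕ → Set
IsReducedWord w word =
  All (λ i → 1 ≤ i × i < length w) word
  × wordPerm (length w) word ≡ w
  × length word ≡ inversions w

isReducedWord? : (w word : List ℕ) → Dec (IsReducedWord w word)
isReducedWord? w word =
  all? (λ i → (1 ≤? i) ×-dec (i <? length w)) word
  ×-dec (LP.≡-dec _≟_ (wordPerm (length w) word) w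
  ×-dec (length word ≟ inversions w))

-- Partitions: weakly decreasing lists of positive integers (English
-- convention: λ = [λ₁, λ₂, …], row i of the diagram has λᵢ cells).

IsPartition : ℕ → List ℕ → Set
IsPartition n μ = sum μ ≡ n × All (λ k → 1 ≤ k) μ × Linked _≥_ μ

-- Fillings of a Young diagram: a list of rows, each a list of entries.

Filling : Set
Filling = List (List ℕ)

HasShape : List ℕ → Filling → Set
HasShape μ T = map length T ≡ μ

-- the (j+1)-st entry of a row, if it exists
nth : ℕ → List ℕ → List ℕ
nth _ [] = []
nth zero (x ∷ _) = x ∷ []
nth (suc j) (_ ∷ xs) = nth j xs

-- column j (0-indexed), read top to bottom
column : ℕ → Filling → List ℕ
column j T = concatMap (nth j) T

width : Filling → ℕ
width T = foldr (λ r k → length r ⊔ k) 0 T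

-- column reading word: columns from right to left, each top to bottom
columnReading : Filling → List ℕ
columnReading T = concatMap (λ j → column j T) (reverse (upTo (width T)))

entries : Filling → List ℕ
entries T = concatMap (λ r → r) T

IsIncreasing : Filling → Set
IsIncreasing T =
  All (All (λ x → 1 ≤ x)) T
  × All (Linked _<_) T
  × All (λ j → Linked _<_ (column j T)) (upTo (width T))

isIncreasing? : (T : Filling) → Dec (IsIncreasing T)
isIncreasing? T =
  all? (all? (λ x → 1 ≤? x)) T
  ×-dec (all? (linked? _<?_) T
  ×-dec all? (λ j → linked? _<?_ (column j T)) (upTo (width T)))

rowsOf : ℕ → ℕ → List (List ℕ)
rowsOf B zero = [] ∷ []
rowsOf B (suc k) = concatMap (λ x → map (x ∷_) (rowsOf B k)) (idPerm B)

fillingsUpTo : ℕ → List ℕ → List Filling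
fillingsUpTo B μ = foldr (λ k acc → concatMap (λ r → map (r ∷_) acc) (rowsOf B k)) ([] ∷ []) μ

-- Every letter of a
-- reduced word of w ∈ S_m lies in {1,…,m-1}, so all such fillings occur
-- among the fillings with entries in {1,…,m-1}.

IsRWFilling : List ℕ → Filling → Set
IsRWFilling w T = IsIncreasing T × IsReducedWord w (columnReading T)

isRWFilling? : (w : List ℕ) → (T : Filling) → Dec (IsRWFilling w T)
isRWFilling? w T = isIncreasing? T ×-dec isReducedWord? w (columnReading T)

a : List ℕ → List ℕ → ℕ
a w μ = length (filter (isRWFilling? w) (fillingsUpTo (length w ∸ 1) μ))

-- f^λ: number of standard Young tableaux of shape λ, i.e. increasing
-- fillings using each of 1, …, |λ| exactly once (entries in {1,…,|λ|},
-- each of 1,…,|λ| occurring; there are |λ| cells).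

IsSYT : List ℕ → Filling → Set
IsSYT μ T = IsIncreasing T × All (λ k → k ∈ entries T) (idPerm (sum μ))

isSYT? : (μ : List ℕ) → (T : Filling) → Dec (IsSYT μ T)
isSYT? μ T = isIncreasing? T ×-dec all? (λ k → k ∈? entries T) (idPerm (sum μ))

f : List ℕ → ℕ
f μ = length (filter (isSYT? μ) (fillingsUpTo (sum μ) μ))

sigma : ℕ → List ℕ
sigma n = concatMap (λ k → (2 * k + 2) ∷ (2 * k + 1) ∷ []) (upTo n)

module Submission where

-- Odd indices are pairwise non-adjacent, so the transpositions s₁, s₃, …, s₂ₙ₋₁ commute; their
-- product is σ⁽ⁿ⁾, hence every rearrangement of 1 3 ⋯ (2n-1) is a reduced word of σ⁽ⁿ⁾.
-- Conversely a reduced word of σ⁽ⁿ⁾ has length inv σ⁽ⁿ⁾ = n and contains every letter 2k+1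
-- (k < n): without it no entry crosses the boundary between positions 2k+1 and 2k+2, while σ⁽ⁿ⁾
-- moves 2k+2 to position 2k+1. So the reduced words of σ⁽ⁿ⁾ are exactly the rearrangements of
-- 1 3 ⋯ (2n-1). The fillings counted by a_{σ⁽ⁿ⁾,λ} therefore have odd entries only, and
-- x ↦ 2x-1 maps them bijectively onto the increasing fillings whose entries are a rearrangement
-- of 1, …, n, i.e. onto the standard Young tableaux of shape λ.

open import Defs

open import Data.Bool using (true; false)
import Data.List as List
open import Data.List
  using (List; []; _∷_; _++_; concat; map; concatMap; filter; foldl; length; take; reverse; upTo; applyUpTo;
         cartesianProductWith)
open import Data.List.Properties
  using (++-assoc; map-++; map-∘; map-injective; map-cong-local; length-++; length-map; concatMap-map;
         concatMap-cong; map-concatMap; map-upTo; map-applyUpTo; length-applyUpTo; take-map;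
         filter-++; filter-accept; filter-reject; filter-≐; filter-none)
open import Data.List.Membership.Propositional using (_∈_; _∉_)
open import Data.List.Membership.Propositional.Properties using (∈-∃++)
open import Data.List.Relation.Binary.Permutation.Propositional
  using (_↭_; ↭-refl; ↭-reflexive; ↭-sym; ↭-trans; module PermutationReasoning)
import Data.List.Relation.Binary.Permutation.Propositional as ↭
open import Data.List.Relation.Binary.Permutation.Propositional.Properties
  using (map⁺; ↭-map-inv; ↭-reverse; ++⁺ˡ; shifts; shift; ↭-length; ∈-resp-↭; All-resp-↭)
open import Data.List.Relation.Unary.All using (All; []; _∷_)
import Data.List.Relation.Unary.All as All
import Data.List.Relation.Unary.All.Properties as AllP
open import Data.List.Relation.Unary.Any using (Any; here; there)
import Data.List.Relation.Unary.Any as Any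
import Data.List.Relation.Unary.Any.Properties as AnyP
open import Data.List.Relation.Unary.Linked using (Linked)
import Data.List.Relation.Unary.Linked as Linked
import Data.List.Relation.Unary.Linked.Properties as LinkedP
open import Data.List.Relation.Unary.Unique.Propositional using (Unique; []; _∷_)
import Data.List.Relation.Unary.Unique.Propositional.Properties as Unique
open import Data.Nat using (ℕ; zero; suc; _+_; _∸_; _*_; _⊔_; _≤_; _<_; _<?_; _≟_; z≤n; s≤s; parity; ⌈_/2⌉)
open import Data.Nat.ListAction using (sum)
open import Data.Nat.Properties
  using (suc-injective; +-suc; *-suc; ≤-pred; ≤-reflexive; ≤-trans; m≤m+n; m≤m⊔n; m≤n⊔m; +-mono-≤;
         <-cmp; <-irrefl; <-asym; <⇒≢; <⇒≱; ≤⇒≯; n≡⌊n+n/2⌋)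
open import Data.List.Membership.DecPropositional _≟_ using (_∈?_)
open import Data.Parity.Base using (1ℙ; _⁻¹)
import Data.Parity.Properties as ℙ
open import Data.Parity.Properties using (suc-homo-⁻¹)
open import Data.Product using (_×_; _,_; proj₁)
open import Function using (_∘_; _⇔_; Equivalence; mk⇔)
open import Relation.Binary.Definitions using (tri<; tri≈; tri>)
open import Relation.Binary.PropositionalEquality
  using (_≡_; _≢_; refl; sym; trans; cong; cong₂; subst; ≢-sym; setoid; module ≡-Reasoning)
open import Relation.Nullary using (Dec; yes; no; does; contradiction)
open import Relation.Unary using (Decidable; _⊆_)

private variable A B : Set

-- Rearrangements, filters and products of lists

concatMap-↭ : ∀ (f : A → List B) {xs ys} → xs ↭ ys → concatMap f xs ↭ concatMap f ys
concatMap-↭ f ↭.refl = ↭-refl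
concatMap-↭ f (↭.prep x p) = ++⁺ˡ (f x) (concatMap-↭ f p)
concatMap-↭ f (↭.swap x y p) = ↭-trans (shifts (f x) (f y)) (++⁺ˡ (f y) (++⁺ˡ (f x) (concatMap-↭ f p)))
concatMap-↭ f (↭.trans p q) = ↭-trans (concatMap-↭ f p) (concatMap-↭ f q)

concatMap-++-↭ : ∀ (f g : A → List B) xs → concatMap (λ x → f x ++ g x) xs ↭ concatMap f xs ++ concatMap g xs
concatMap-++-↭ f g [] = ↭-refl
concatMap-++-↭ f g (x ∷ xs) = begin
  (f x ++ g x) ++ concatMap (λ x → f x ++ g x) xs ≡⟨ ++-assoc (f x) (g x) _ ⟩
  f x ++ g x ++ concatMap (λ x → f x ++ g x) xs    ↭⟨ ++⁺ˡ (f x) (++⁺ˡ (g x) (concatMap-++-↭ f g xs)) ⟩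
  f x ++ g x ++ concatMap f xs ++ concatMap g xs   ↭⟨ ++⁺ˡ (f x) (shifts (g x) (concatMap f xs)) ⟩
  f x ++ concatMap f xs ++ g x ++ concatMap g xs   ≡⟨ ++-assoc (f x) (concatMap f xs) _ ⟨
  (f x ++ concatMap f xs) ++ g x ++ concatMap g xs ∎
  where open PermutationReasoning

concatMap-const-[] : ∀ (xs : List A) → concatMap (λ _ → []) xs ≡ ([] {A = B})
concatMap-const-[] [] = refl
concatMap-const-[] (x ∷ xs) = concatMap-const-[] xs

concatMap-comm-↭ : ∀ {C : Set} (f : A → B → List C) xs ys →
  concatMap (λ x → concatMap (f x) ys) xs ↭ concatMap (λ y → concatMap (λ x → f x y) xs) ys
concatMap-comm-↭ f [] ys = ↭-sym (↭-reflexive (concatMap-const-[] ys))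
concatMap-comm-↭ f (x ∷ xs) ys = begin
  concatMap (f x) ys ++ concatMap (λ x → concatMap (f x) ys) xs
    ↭⟨ ++⁺ˡ (concatMap (f x) ys) (concatMap-comm-↭ f xs ys) ⟩
  concatMap (f x) ys ++ concatMap (λ y → concatMap (λ x → f x y) xs) ys
    ↭⟨ concatMap-++-↭ (f x) (λ y → concatMap (λ x → f x y) xs) ys ⟨
  concatMap (λ y → f x y ++ concatMap (λ x → f x y) xs) ys ∎
  where open PermutationReasoning

↭-map⁻ : ∀ {f : A → B} → (∀ {x y} → f x ≡ f y → x ≡ y) → ∀ {xs ys} → map f xs ↭ map f ys → xs ↭ ys
↭-map⁻ f-injective p with ys′ , fys≡fys′ , xs↭ys′ ← ↭-map-inv _ p =
  subst (_ ↭_) (sym (map-injective f-injective fys≡fys′)) xs↭ys′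

unique⊆⇒↭ : ∀ {ds ws : List A} → Unique ds → All (_∈ ws) ds → length ws ≤ length ds → ws ↭ ds
unique⊆⇒↭ {ds = []} {[]} [] [] _ = ↭-refl
unique⊆⇒↭ {ds = d ∷ ds} (d∉ds ∷ unique) (d∈ws ∷ ds⊆ws) length≤
  with xs , ys , refl ← ∈-∃++ d∈ws = begin
    xs ++ d ∷ ys ↭⟨ to-front ⟩
    d ∷ xs ++ ys ↭⟨ ↭.prep d (unique⊆⇒↭ unique ds⊆xs++ys (≤-pred length≤′)) ⟩
    d ∷ ds       ∎
  where
  open PermutationReasoning
  to-front : xs ++ d ∷ ys ↭ d ∷ xs ++ ys
  to-front = shift d xs ys
  length≤′ : suc (length (xs ++ ys)) ≤ suc (length ds)
  length≤′ = subst (_≤ suc (length ds)) (↭-length to-front) length≤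
  ds⊆xs++ys : All (_∈ xs ++ ys) ds
  ds⊆xs++ys = All.zipWith (λ { (d≢e , e∈ws) → drop-head d≢e (∈-resp-↭ to-front e∈ws) }) (d∉ds , ds⊆ws)
    where
    drop-head : ∀ {e zs} → d ≢ e → e ∈ d ∷ zs → e ∈ zs
    drop-head d≢e (here e≡d) = contradiction (sym e≡d) d≢e
    drop-head d≢e (there e∈zs) = e∈zs

module _ {P : A → Set} (P? : Decidable P) where

  filter-map : ∀ (f : B → A) xs → filter P? (map f xs) ≡ map f (filter (P? ∘ f) xs)
  filter-map f [] = refl
  filter-map f (x ∷ xs) with does (P? (f x))
  ... | true = cong (f x ∷_) (filter-map f xs)
  ... | false = filter-map f xs

  filter-filter : ∀ {Q : A → Set} (Q? : Decidable Q) → P ⊆ Q → ∀ xs → filter P? (filter Q? xs) ≡ filter P? xs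
  filter-filter Q? P⊆Q [] = refl
  filter-filter Q? P⊆Q (x ∷ xs) with Q? x
  ... | no ¬qx = trans (filter-filter Q? P⊆Q xs) (sym (filter-reject P? (¬qx ∘ P⊆Q)))
  ... | yes _ with does (P? x)
  ...   | true = cong (x ∷_) (filter-filter Q? P⊆Q xs)
  ...   | false = filter-filter Q? P⊆Q xs

  filter-cong-local : ∀ {Q : A → Set} (Q? : Decidable Q) {xs} →
    All (λ x → P x ⇔ Q x) xs → filter P? xs ≡ filter Q? xs
  filter-cong-local Q? [] = refl
  filter-cong-local Q? {x ∷ xs} (P⇔Q ∷ rest) with P? x
  ... | yes px = trans (cong (x ∷_) (filter-cong-local Q? rest)) (sym (filter-accept Q? (Equivalence.to P⇔Q px)))
  ... | no ¬px = trans (filter-cong-local Q? rest) (sym (filter-reject Q? (¬px ∘ Equivalence.from P⇔Q)))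

infixr 5 _⊗_
_⊗_ : List A → List (List A) → List (List A)
_⊗_ = cartesianProductWith List._∷_

concatMap-map-∷ : ∀ (xs : List A) yss → concatMap (λ x → map (x ∷_) yss) xs ≡ xs ⊗ yss
concatMap-map-∷ [] yss = refl
concatMap-map-∷ (x ∷ xs) yss = cong (map (x ∷_) yss ++_) (concatMap-map-∷ xs yss)

map-⊗ : ∀ (f : A → B) xs yss → map (map f) (xs ⊗ yss) ≡ map f xs ⊗ map (map f) yss
map-⊗ f [] yss = refl
map-⊗ f (x ∷ xs) yss = begin
  map (map f) (map (x ∷_) yss ++ xs ⊗ yss)              ≡⟨ map-++ (map f) (map (x ∷_) yss) _ ⟩
  map (map f) (map (x ∷_) yss) ++ map (map f) (xs ⊗ yss) ≡⟨ cong₂ _++_ (trans (sym (map-∘ yss)) (map-∘ yss)) (map-⊗ f xs yss) ⟩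
  map (f x ∷_) (map (map f) yss) ++ map f xs ⊗ map (map f) yss ∎
  where open ≡-Reasoning

filter-all-⊗ : ∀ {P : A → Set} (P? : Decidable P) xs yss →
  filter (All.all? P?) (xs ⊗ yss) ≡ filter P? xs ⊗ filter (All.all? P?) yss
filter-all-⊗ P? [] yss = refl
filter-all-⊗ {P = P} P? (x ∷ xs) yss = begin
  filter (All.all? P?) (map (x ∷_) yss ++ xs ⊗ yss)
    ≡⟨ filter-++ (All.all? P?) (map (x ∷_) yss) _ ⟩
  filter (All.all? P?) (map (x ∷_) yss) ++ filter (All.all? P?) (xs ⊗ yss)
    ≡⟨ cong₂ _++_ (filter-map (All.all? P?) (x ∷_) yss) (filter-all-⊗ P? xs yss) ⟩
  map (x ∷_) (filter (All.all? P? ∘ (x ∷_)) yss) ++ filter P? xs ⊗ tails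
    ≡⟨ first-row (P? x) ⟩
  filter P? (x ∷ xs) ⊗ tails ∎
  where
  open ≡-Reasoning
  tails = filter (All.all? P?) yss
  first-row : Dec (P x) →
    map (x ∷_) (filter (All.all? P? ∘ (x ∷_)) yss) ++ filter P? xs ⊗ tails ≡ filter P? (x ∷ xs) ⊗ tails
  first-row (yes px) = begin
    map (x ∷_) (filter (All.all? P? ∘ (x ∷_)) yss) ++ filter P? xs ⊗ tails
      ≡⟨ cong (λ zss → map (x ∷_) zss ++ filter P? xs ⊗ tails)
              (filter-≐ (All.all? P? ∘ (x ∷_)) (All.all? P?) (All.tail , px ∷_) yss) ⟩
    (x ∷ filter P? xs) ⊗ tails ≡⟨ cong (_⊗ tails) (filter-accept P? px) ⟨
    filter P? (x ∷ xs) ⊗ tails ∎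
  first-row (no ¬px) = begin
    map (x ∷_) (filter (All.all? P? ∘ (x ∷_)) yss) ++ filter P? xs ⊗ tails
      ≡⟨ cong (λ zss → map (x ∷_) zss ++ filter P? xs ⊗ tails)
              (filter-none (All.all? P? ∘ (x ∷_)) (All.universal (λ _ → ¬px ∘ All.head) yss)) ⟩
    filter P? xs ⊗ tails       ≡⟨ cong (_⊗ tails) (filter-reject P? ¬px) ⟨
    filter P? (x ∷ xs) ⊗ tails ∎

-- Odd numbers

-- x ↦ 2x-1, defined so that toOdd (2 + x) reduces to 2 + toOdd (1 + x).
toOdd : ℕ → ℕ
toOdd zero = zero
toOdd (suc zero) = 1
toOdd (suc (suc x)) = 2 + toOdd (suc x)

Odd : ℕ → Set
Odd i = parity i ≡ 1ℙ

Odd? : Decidable Odd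
Odd? i = parity i ℙ.≟ 1ℙ

odds : ℕ → List ℕ
odds n = map toOdd (idPerm n)

toOdd-odd : ∀ k → Odd (toOdd (suc k))
toOdd-odd zero = refl
toOdd-odd (suc k) = toOdd-odd k

toOdd-mono-< : ∀ {x y} → x < y → toOdd x < toOdd y
toOdd-mono-< {zero} {suc zero} _ = s≤s z≤n
toOdd-mono-< {zero} {suc (suc y)} _ = s≤s z≤n
toOdd-mono-< {suc zero} {suc zero} (s≤s ())
toOdd-mono-< {suc zero} {suc (suc y)} _ = s≤s (s≤s z≤n)
toOdd-mono-< {suc (suc x)} {suc (suc y)} (s≤s x<y) = s≤s (s≤s (toOdd-mono-< x<y))

toOdd-cancel-< : ∀ {x y} → toOdd x < toOdd y → x < y
toOdd-cancel-< {x} {y} lt with <-cmp x y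
... | tri< x<y _ _ = x<y
... | tri≈ _ refl _ = contradiction lt (<-irrefl refl)
... | tri> _ _ y<x = contradiction lt (<-asym (toOdd-mono-< y<x))

toOdd-injective : ∀ {x y} → toOdd x ≡ toOdd y → x ≡ y
toOdd-injective {x} {y} eq with <-cmp x y
... | tri< x<y _ _ = contradiction eq (<⇒≢ (toOdd-mono-< x<y))
... | tri≈ _ x≡y _ = x≡y
... | tri> _ _ y<x = contradiction eq (≢-sym (<⇒≢ (toOdd-mono-< y<x)))

toOdd-embedding : ∀ {x y} → x < y ⇔ toOdd x < toOdd y
toOdd-embedding = mk⇔ toOdd-mono-< toOdd-cancel-<

toOdd-suc<double : ∀ k → toOdd (suc k) < suc k + suc k
toOdd-suc<double zero = s≤s (s≤s z≤n)
toOdd-suc<double (suc k) =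
  subst (toOdd (2 + k) <_) (cong suc (sym (+-suc (suc k) (suc k)))) (s≤s (s≤s (toOdd-suc<double k)))

odd-nonadjacent : ∀ {i j} → Odd i → Odd j → i ≢ suc j
odd-nonadjacent {j = j} odd-i odd-j refl
  with () ← trans (sym (cong _⁻¹ odd-i)) (trans (suc-homo-⁻¹ j) odd-j)

idPerm-suc : ∀ m → idPerm (suc m) ≡ 1 ∷ map suc (idPerm m)
idPerm-suc m = cong (1 ∷_) (sym (map-applyUpTo suc suc m))

idPerm-suc-suc : ∀ m → idPerm (2 + m) ≡ 1 ∷ 2 ∷ map (2 +_) (idPerm m)
idPerm-suc-suc m = cong (λ xs → 1 ∷ 2 ∷ xs) (sym (map-applyUpTo suc (2 +_) m))

idPerm-unique : ∀ m → Unique (idPerm m)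
idPerm-unique m = Unique.applyUpTo⁺₁ suc m (λ i<j _ → <⇒≢ i<j ∘ suc-injective)

odds-suc : ∀ n → odds (suc n) ≡ 1 ∷ map (2 +_) (odds n)
odds-suc n = cong (1 ∷_) (begin
  map toOdd (applyUpTo (suc ∘ suc) n)       ≡⟨ map-applyUpTo (suc ∘ suc) toOdd n ⟩
  applyUpTo (toOdd ∘ suc ∘ suc) n           ≡⟨ map-applyUpTo (toOdd ∘ suc) (2 +_) n ⟨
  map (2 +_) (applyUpTo (toOdd ∘ suc) n)    ≡⟨ cong (map (2 +_)) (map-applyUpTo suc toOdd n) ⟨
  map (2 +_) (odds n)                       ∎)
  where open ≡-Reasoning

length-odds : ∀ n → length (odds n) ≡ n
length-odds n = trans (length-map toOdd (idPerm n)) (length-applyUpTo suc n)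

odds-unique : ∀ n → Unique (odds n)
odds-unique n = Unique.map⁺ toOdd-injective (idPerm-unique n)

All-odds : ∀ {P : ℕ → Set} n → (∀ {k} → k < n → P (toOdd (suc k))) → All P (odds n)
All-odds n P-odd = AllP.map⁺ (AllP.applyUpTo⁺₁ suc n P-odd)

odds-odd : ∀ n → All Odd (odds n)
odds-odd n = All-odds n (λ {k} _ → toOdd-odd k)

odds-within : ∀ n → All (λ i → 1 ≤ i × i < n + n) (odds n)
odds-within n = All-odds n (λ {k} k<n →
  toOdd-mono-< {0} {suc k} (s≤s z≤n) , ≤-trans (toOdd-suc<double k) (+-mono-≤ k<n k<n))

filter-odd-idPerm : ∀ m → filter Odd? (idPerm m) ≡ odds ⌈ m /2⌉
filter-odd-idPerm zero = refl
filter-odd-idPerm (suc zero) = refl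
filter-odd-idPerm (suc (suc m)) = begin
  filter Odd? (idPerm (2 + m))               ≡⟨ cong (filter Odd?) (idPerm-suc-suc m) ⟩
  1 ∷ filter Odd? (map (2 +_) (idPerm m))    ≡⟨ cong (1 ∷_) (filter-map Odd? (2 +_) (idPerm m)) ⟩
  1 ∷ map (2 +_) (filter Odd? (idPerm m))    ≡⟨ cong (λ xs → 1 ∷ map (2 +_) xs) (filter-odd-idPerm m) ⟩
  1 ∷ map (2 +_) (odds ⌈ m /2⌉)              ≡⟨ odds-suc ⌈ m /2⌉ ⟨
  odds ⌈ suc (suc m) /2⌉                     ∎
  where open ≡-Reasoning

-- Products of adjacent transpositions

applySwaps : List ℕ → List ℕ → List ℕ
applySwaps w ws = foldl (λ v i → swapAt i v) w ws

swapAt-map : ∀ (f : ℕ → ℕ) i w → swapAt i (map f w) ≡ map f (swapAt i w)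
swapAt-map f zero w = refl
swapAt-map f (suc zero) [] = refl
swapAt-map f (suc zero) (a ∷ []) = refl
swapAt-map f (suc zero) (a ∷ b ∷ w) = refl
swapAt-map f (suc (suc i)) [] = refl
swapAt-map f (suc (suc i)) (a ∷ w) = cong (f a ∷_) (swapAt-map f (suc i) w)

applySwaps-map : ∀ (f : ℕ → ℕ) w ws → applySwaps (map f w) ws ≡ map f (applySwaps w ws)
applySwaps-map f w [] = refl
applySwaps-map f w (i ∷ ws) = trans (cong (λ v → applySwaps v ws) (swapAt-map f i w)) (applySwaps-map f (swapAt i w) ws)

applySwaps-shift : ∀ a b w {ws} → All (1 ≤_) ws →
  applySwaps (a ∷ b ∷ w) (map (2 +_) ws) ≡ a ∷ b ∷ applySwaps w ws
applySwaps-shift a b w [] = refl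
applySwaps-shift a b w (s≤s z≤n ∷ ws≥1) = applySwaps-shift a b _ ws≥1

swapAt-comm : ∀ i j → i ≢ suc j → j ≢ suc i → ∀ w → swapAt i (swapAt j w) ≡ swapAt j (swapAt i w)
swapAt-comm zero j _ _ w = refl
swapAt-comm (suc i) zero _ _ w = refl
swapAt-comm (suc zero) (suc zero) _ _ w = refl
swapAt-comm (suc zero) (suc (suc zero)) _ j≢2 w = contradiction refl j≢2
swapAt-comm (suc zero) (suc (suc (suc j))) _ _ [] = refl
swapAt-comm (suc zero) (suc (suc (suc j))) _ _ (a ∷ []) = refl
swapAt-comm (suc zero) (suc (suc (suc j))) _ _ (a ∷ b ∷ w) = refl
swapAt-comm (suc (suc zero)) (suc zero) i≢2 _ w = contradiction refl i≢2
swapAt-comm (suc (suc (suc i))) (suc zero) _ _ [] = refl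
swapAt-comm (suc (suc (suc i))) (suc zero) _ _ (a ∷ []) = refl
swapAt-comm (suc (suc (suc i))) (suc zero) _ _ (a ∷ b ∷ w) = refl
swapAt-comm (suc (suc i)) (suc (suc j)) _ _ [] = refl
swapAt-comm (suc (suc i)) (suc (suc j)) i≢ j≢ (a ∷ w) =
  cong (a ∷_) (swapAt-comm (suc i) (suc j) (i≢ ∘ cong suc) (j≢ ∘ cong suc) w)

module _ {P : ℕ → Set} (nonadjacent : ∀ {i j} → P i → P j → i ≢ suc j) where

  applySwaps-↭ : ∀ {ws ws′} → ws ↭ ws′ → All P ws → ∀ w → applySwaps w ws ≡ applySwaps w ws′
  applySwaps-↭ ↭.refl _ w = refl
  applySwaps-↭ (↭.prep i p) (_ ∷ ps) w = applySwaps-↭ p ps (swapAt i w)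
  applySwaps-↭ {i ∷ j ∷ ws} (↭.swap i j p) (pi ∷ pj ∷ ps) w =
    trans (cong (λ v → applySwaps v ws) (swapAt-comm j i (nonadjacent pj pi) (nonadjacent pi pj) w))
          (applySwaps-↭ p ps (swapAt i (swapAt j w)))
  applySwaps-↭ (↭.trans p q) ps w = trans (applySwaps-↭ p ps w) (applySwaps-↭ q (All-resp-↭ p ps) w)

swapAt-take-↭ : ∀ i j → j ≢ i → ∀ w → take i (swapAt j w) ↭ take i w
swapAt-take-↭ i zero _ w = ↭-refl
swapAt-take-↭ zero (suc j) _ w = ↭-refl
swapAt-take-↭ (suc zero) (suc zero) 1≢1 w = contradiction refl 1≢1
swapAt-take-↭ (suc (suc i)) (suc zero) _ [] = ↭-refl
swapAt-take-↭ (suc (suc i)) (suc zero) _ (a ∷ []) = ↭-refl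
swapAt-take-↭ (suc (suc i)) (suc zero) _ (a ∷ b ∷ w) = ↭.swap b a ↭-refl
swapAt-take-↭ (suc i) (suc (suc j)) _ [] = ↭-refl
swapAt-take-↭ (suc i) (suc (suc j)) j≢i (a ∷ w) = ↭.prep a (swapAt-take-↭ i (suc j) (j≢i ∘ cong suc) w)

applySwaps-take-↭ : ∀ i {ws} → i ∉ ws → ∀ w → take i (applySwaps w ws) ↭ take i w
applySwaps-take-↭ i {[]} _ w = ↭-refl
applySwaps-take-↭ i {j ∷ ws} i∉j∷ws w =
  ↭-trans (applySwaps-take-↭ i (i∉j∷ws ∘ there) (swapAt j w)) (swapAt-take-↭ i j (i∉j∷ws ∘ here ∘ sym) w)

-- The permutation σ⁽ⁿ⁾ and its reduced words

sigma-suc : ∀ n → sigma (suc n) ≡ 2 ∷ 1 ∷ map (2 +_) (sigma n)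
sigma-suc n = cong (λ xs → 2 ∷ 1 ∷ xs) (begin
  concatMap block (applyUpTo suc n)          ≡⟨ cong (concatMap block) (map-upTo suc n) ⟨
  concatMap block (map suc (upTo n))         ≡⟨ concatMap-map block suc (upTo n) ⟩
  concatMap (block ∘ suc) (upTo n)           ≡⟨ concatMap-cong block-suc (upTo n) ⟩
  concatMap (map (2 +_) ∘ block) (upTo n)    ≡⟨ map-concatMap (2 +_) block (upTo n) ⟨
  map (2 +_) (sigma n)                       ∎)
  where
  open ≡-Reasoning
  block : ℕ → List ℕ
  block k = (2 * k + 2) ∷ (2 * k + 1) ∷ []
  block-suc : ∀ k → block (suc k) ≡ map (2 +_) (block k)
  block-suc k = cong₂ (λ x y → x ∷ y ∷ []) (cong (_+ 2) (*-suc 2 k)) (cong (_+ 1) (*-suc 2 k))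

length-sigma : ∀ n → length (sigma n) ≡ n + n
length-sigma zero = refl
length-sigma (suc n) = begin
  length (sigma (suc n))           ≡⟨ cong length (sigma-suc n) ⟩
  2 + length (map (2 +_) (sigma n)) ≡⟨ cong (2 +_) (trans (length-map (2 +_) (sigma n)) (length-sigma n)) ⟩
  2 + (n + n)                      ≡⟨ cong suc (+-suc n n) ⟨
  suc n + suc n                    ∎
  where open ≡-Reasoning

inversions-map : ∀ {f : ℕ → ℕ} → (∀ {x y} → x < y ⇔ f x < f y) → ∀ xs → inversions (map f xs) ≡ inversions xs
inversions-map f-embedding [] = refl
inversions-map {f} f-embedding (x ∷ xs) = cong₂ _+_ smaller (inversions-map f-embedding xs)
  where
  smaller : length (filter (_<? f x) (map f xs)) ≡ length (filter (_<? x) xs)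
  smaller = begin
    length (filter (_<? f x) (map f xs))           ≡⟨ cong length (filter-map (_<? f x) f xs) ⟩
    length (map f (filter ((_<? f x) ∘ f) xs))     ≡⟨ length-map f (filter ((_<? f x) ∘ f) xs) ⟩
    length (filter ((_<? f x) ∘ f) xs)             ≡⟨ cong length (filter-≐ ((_<? f x) ∘ f) (_<? x)
                                                         (Equivalence.from f-embedding , Equivalence.to f-embedding) xs) ⟩
    length (filter (_<? x) xs)                     ∎
    where open ≡-Reasoning

inversions-sigma : ∀ n → inversions (sigma n) ≡ n
inversions-sigma zero = refl
inversions-sigma (suc n) = begin
  inversions (sigma (suc n))
    ≡⟨ cong inversions (sigma-suc n) ⟩
  inversions (2 ∷ 1 ∷ map (2 +_) (sigma n))
    ≡⟨ cong₂ (λ a b → suc (length a + (length b + inversions (map (2 +_) (sigma n)))))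
             (none-below (s≤s (s≤s z≤n))) (none-below (s≤s z≤n)) ⟩
  suc (inversions (map (2 +_) (sigma n)))
    ≡⟨ cong suc (inversions-map (mk⇔ (s≤s ∘ s≤s) (≤-pred ∘ ≤-pred)) (sigma n)) ⟩
  suc (inversions (sigma n))
    ≡⟨ cong suc (inversions-sigma n) ⟩
  suc n ∎
  where
  open ≡-Reasoning
  none-below : ∀ {c} → c ≤ 2 → filter (_<? c) (map (2 +_) (sigma n)) ≡ []
  none-below c≤2 = filter-none (_<? _)
    (AllP.map⁺ (All.universal (λ y 2+y<c → <⇒≱ 2+y<c (≤-trans c≤2 (m≤m+n 2 y))) (sigma n)))

applySwaps-odds : ∀ n → applySwaps (idPerm (n + n)) (odds n) ≡ sigma n
applySwaps-odds zero = refl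
applySwaps-odds (suc n) = begin
  applySwaps (idPerm (suc n + suc n)) (odds (suc n))
    ≡⟨ cong₂ applySwaps (cong idPerm (cong suc (+-suc n n))) (odds-suc n) ⟩
  applySwaps (idPerm (2 + (n + n))) (1 ∷ map (2 +_) (odds n))
    ≡⟨ cong (λ v → applySwaps v (1 ∷ map (2 +_) (odds n))) (idPerm-suc-suc (n + n)) ⟩
  applySwaps (2 ∷ 1 ∷ map (2 +_) (idPerm (n + n))) (map (2 +_) (odds n))
    ≡⟨ applySwaps-shift 2 1 _ (All.map proj₁ (odds-within n)) ⟩
  2 ∷ 1 ∷ applySwaps (map (2 +_) (idPerm (n + n))) (odds n)
    ≡⟨ cong (λ xs → 2 ∷ 1 ∷ xs) (trans (applySwaps-map (2 +_) _ (odds n)) (cong (map (2 +_)) (applySwaps-odds n))) ⟩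
  2 ∷ 1 ∷ map (2 +_) (sigma n)
    ≡⟨ sigma-suc n ⟨
  sigma (suc n) ∎
  where open ≡-Reasoning

sigma-prefix : ∀ {k n} → k < n → Any (toOdd (suc k) <_) (take (toOdd (suc k)) (sigma n))
sigma-prefix {zero} {suc n} _ = here (s≤s (s≤s z≤n))
sigma-prefix {suc k} {suc n} (s≤s k<n) =
  subst (λ s → Any (toOdd (2 + k) <_) (take (toOdd (2 + k)) s)) (sym (sigma-suc n))
    (there (there (subst (Any _) (sym (take-map (toOdd (suc k)) (sigma n)))
                         (AnyP.map⁺ (Any.map (s≤s ∘ s≤s) (sigma-prefix k<n))))))

idPerm-prefix : ∀ i m → All (_≤ i) (take i (idPerm m))
idPerm-prefix zero m = []
idPerm-prefix (suc i) zero = []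
idPerm-prefix (suc i) (suc m) =
  subst (λ xs → All (_≤ suc i) (take (suc i) xs)) (sym (idPerm-suc m))
    (s≤s z≤n ∷ subst (All (_≤ suc i)) (sym (take-map i (idPerm m))) (AllP.map⁺ (All.map s≤s (idPerm-prefix i m))))

odds⊆word-of-sigma : ∀ n {ws} → applySwaps (idPerm (n + n)) ws ≡ sigma n → All (_∈ ws) (odds n)
odds⊆word-of-sigma n {ws} word≡σ = All-odds n present
  where
  present : ∀ {k} → k < n → toOdd (suc k) ∈ ws
  present {k} k<n with toOdd (suc k) ∈? ws
  ... | yes i∈ws = i∈ws
  ... | no i∉ws = contradiction (sigma-prefix k<n) (AllP.All¬⇒¬Any (All.map ≤⇒≯ prefix-bounded))
    where
    i = toOdd (suc k)
    prefix-bounded : All (_≤ i) (take i (sigma n))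
    prefix-bounded = All-resp-↭
      (↭-sym (subst (λ v → take i v ↭ take i (idPerm (n + n))) word≡σ (applySwaps-take-↭ i i∉ws _)))
      (idPerm-prefix i (n + n))

reducedWord-sigma⇒↭odds : ∀ n {ws} → IsReducedWord (sigma n) ws → ws ↭ odds n
reducedWord-sigma⇒↭odds n {ws} (_ , word≡σ , length≡) =
  unique⊆⇒↭ (odds-unique n)
    (odds⊆word-of-sigma n (subst (λ m → applySwaps (idPerm m) ws ≡ sigma n) (length-sigma n) word≡σ))
    (≤-reflexive (trans length≡ (trans (inversions-sigma n) (sym (length-odds n)))))

↭odds⇒reducedWord-sigma : ∀ n {ws} → ws ↭ odds n → IsReducedWord (sigma n) ws
↭odds⇒reducedWord-sigma n {ws} ws↭odds = letters , word≡σ , length≡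
  where
  letters : All (λ i → 1 ≤ i × i < length (sigma n)) ws
  letters = All-resp-↭ (↭-sym ws↭odds)
    (subst (λ m → All (λ i → 1 ≤ i × i < m) (odds n)) (sym (length-sigma n)) (odds-within n))
  word≡σ : applySwaps (idPerm (length (sigma n))) ws ≡ sigma n
  word≡σ = begin
    applySwaps (idPerm (length (sigma n))) ws  ≡⟨ cong (λ m → applySwaps (idPerm m) ws) (length-sigma n) ⟩
    applySwaps (idPerm (n + n)) ws             ≡⟨ applySwaps-↭ odd-nonadjacent ws↭odds (All-resp-↭ (↭-sym ws↭odds) (odds-odd n)) _ ⟩
    applySwaps (idPerm (n + n)) (odds n)       ≡⟨ applySwaps-odds n ⟩
    sigma n                                    ∎
    where open ≡-Reasoning
  length≡ : length ws ≡ inversions (sigma n)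
  length≡ = trans (↭-length ws↭odds) (trans (length-odds n) (sym (inversions-sigma n)))

-- Fillings

nth-map : ∀ (f : ℕ → ℕ) j r → nth j (map f r) ≡ map f (nth j r)
nth-map f j [] = refl
nth-map f zero (x ∷ r) = refl
nth-map f (suc j) (x ∷ r) = nth-map f j r

column-map : ∀ (f : ℕ → ℕ) j T → column j (map (map f) T) ≡ map f (column j T)
column-map f j T = begin
  concatMap (nth j) (map (map f) T)   ≡⟨ concatMap-map (nth j) (map f) T ⟩
  concatMap (nth j ∘ map f) T         ≡⟨ concatMap-cong (nth-map f j) T ⟩
  concatMap (map f ∘ nth j) T         ≡⟨ map-concatMap f (nth j) T ⟨
  map f (concatMap (nth j) T)         ∎
  where open ≡-Reasoning

width-map : ∀ (f : ℕ → ℕ) T → width (map (map f) T) ≡ width T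
width-map f [] = refl
width-map f (r ∷ T) = cong₂ _⊔_ (length-map f r) (width-map f T)

columnReading-map : ∀ (f : ℕ → ℕ) T → columnReading (map (map f) T) ≡ map f (columnReading T)
columnReading-map f T = begin
  concatMap (λ j → column j (map (map f) T)) (reverse (upTo (width (map (map f) T))))
    ≡⟨ cong (λ w → concatMap (λ j → column j (map (map f) T)) (reverse (upTo w))) (width-map f T) ⟩
  concatMap (λ j → column j (map (map f) T)) (reverse (upTo (width T)))
    ≡⟨ concatMap-cong (λ j → column-map f j T) (reverse (upTo (width T))) ⟩
  concatMap (map f ∘ λ j → column j T) (reverse (upTo (width T)))
    ≡⟨ map-concatMap f (λ j → column j T) (reverse (upTo (width T))) ⟨
  map f (columnReading T) ∎
  where open ≡-Reasoning

rows-within-width : ∀ T → All (λ r → length r ≤ width T) T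
rows-within-width [] = []
rows-within-width (r ∷ T) =
  m≤m⊔n (length r) (width T) ∷ All.map (λ r≤ → ≤-trans r≤ (m≤n⊔m (length r) (width T))) (rows-within-width T)

concatMap-nth : ∀ r w → length r ≤ w → concatMap (λ j → nth j r) (upTo w) ≡ r
concatMap-nth [] w _ = concatMap-const-[] (upTo w)
concatMap-nth (x ∷ r) (suc w) (s≤s r≤w) = cong (x ∷_) (begin
  concatMap (λ j → nth j (x ∷ r)) (applyUpTo suc w)       ≡⟨ cong (concatMap (λ j → nth j (x ∷ r))) (map-upTo suc w) ⟨
  concatMap (λ j → nth j (x ∷ r)) (map suc (upTo w))      ≡⟨ concatMap-map (λ j → nth j (x ∷ r)) suc (upTo w) ⟩
  concatMap (λ j → nth j r) (upTo w)                      ≡⟨ concatMap-nth r w r≤w ⟩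
  r                                                       ∎)
  where open ≡-Reasoning

columnReading-↭-entries : ∀ T → columnReading T ↭ entries T
columnReading-↭-entries T = begin
  concatMap (λ j → concatMap (nth j) T) (reverse (upTo (width T)))
    ↭⟨ concatMap-↭ (λ j → concatMap (nth j) T) (↭-reverse (upTo (width T))) ⟩
  concatMap (λ j → concatMap (nth j) T) (upTo (width T))
    ↭⟨ concatMap-comm-↭ nth (upTo (width T)) T ⟩
  concatMap (λ r → concatMap (λ j → nth j r) (upTo (width T))) T
    ≡⟨ cong concat (map-cong-local (All.map (λ {r} → concatMap-nth r (width T)) (rows-within-width T))) ⟩
  entries T ∎
  where open PermutationReasoning

length-entries : ∀ T → length (entries T) ≡ sum (map length T)
length-entries [] = refl
length-entries (r ∷ T) = trans (length-++ r) (cong (length r +_) (length-entries T))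

module _ {f : ℕ → ℕ} (f-embedding : ∀ {x y} → x < y ⇔ f x < f y) (f-zero : f 0 ≡ 0) where

  private
    mono : ∀ {x y} → x < y → f x < f y
    mono = Equivalence.to f-embedding
    cancel : ∀ {x y} → f x < f y → x < y
    cancel = Equivalence.from f-embedding
    positive-to : ∀ {x} → 1 ≤ x → 1 ≤ f x
    positive-to {x} = subst (_< f x) f-zero ∘ mono
    positive-from : ∀ {x} → 1 ≤ f x → 1 ≤ x
    positive-from {x} = cancel ∘ subst (_< f x) (sym f-zero)

  isIncreasing-map⇔ : ∀ T → IsIncreasing T ⇔ IsIncreasing (map (map f) T)
  isIncreasing-map⇔ T = mk⇔
    (λ (positive , rows , columns) →
      AllP.map⁺ (All.map (AllP.map⁺ ∘ All.map positive-to) positive) ,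
      AllP.map⁺ (All.map (LinkedP.map⁺ ∘ Linked.map mono) rows) ,
      subst (λ w → All (λ j → Linked _<_ (column j (map (map f) T))) (upTo w)) (sym (width-map f T))
        (All.map (λ {j} → subst (Linked _<_) (sym (column-map f j T)) ∘ LinkedP.map⁺ ∘ Linked.map mono) columns))
    (λ (positive , rows , columns) →
      All.map (All.map positive-from ∘ AllP.map⁻) (AllP.map⁻ positive) ,
      All.map (Linked.map cancel ∘ LinkedP.map⁻) (AllP.map⁻ rows) ,
      All.map (λ {j} → Linked.map cancel ∘ LinkedP.map⁻ ∘ subst (Linked _<_) (column-map f j T))
        (subst (λ w → All (λ j → Linked _<_ (column j (map (map f) T))) (upTo w)) (width-map f T) columns))

rwFilling-sigma⇒odd : ∀ n {T} → IsRWFilling (sigma n) T → All (All Odd) T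
rwFilling-sigma⇒odd n {T} (_ , reduced) =
  AllP.map⁻ (AllP.concat⁻ (All-resp-↭ (columnReading-↭-entries T)
    (All-resp-↭ (↭-sym (reducedWord-sigma⇒↭odds n reduced)) (odds-odd n))))

isRWFilling-sigma⇔isSYT : ∀ μ {T} → HasShape μ T → IsRWFilling (sigma (sum μ)) (map (map toOdd) T) ⇔ IsSYT μ T
isRWFilling-sigma⇔isSYT μ {T} shape = mk⇔
  (λ (increasing , reduced) →
    Equivalence.from (isIncreasing-map⇔ toOdd-embedding refl T) increasing ,
    All.map (∈-resp-↭ (↭-sym (rw-entries↭idPerm reduced))) (All.tabulate (λ k∈ → k∈)))
  (λ (increasing , all-entries) →
    Equivalence.to (isIncreasing-map⇔ toOdd-embedding refl T) increasing ,
    ↭odds⇒reducedWord-sigma n (begin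
      columnReading (map (map toOdd) T) ≡⟨ columnReading-map toOdd T ⟩
      map toOdd (columnReading T)       ↭⟨ map⁺ toOdd (columnReading-↭-entries T) ⟩
      map toOdd (entries T)             ↭⟨ map⁺ toOdd (syt-entries↭idPerm all-entries) ⟩
      odds n                            ∎))
  where
  open PermutationReasoning
  n = sum μ
  syt-entries↭idPerm : All (_∈ entries T) (idPerm n) → entries T ↭ idPerm n
  syt-entries↭idPerm all-entries = unique⊆⇒↭ (idPerm-unique n) all-entries
    (≤-reflexive (trans (length-entries T) (trans (cong sum shape) (sym (length-applyUpTo suc n)))))
  rw-entries↭idPerm : IsReducedWord (sigma n) (columnReading (map (map toOdd) T)) → entries T ↭ idPerm n
  rw-entries↭idPerm reduced = ↭-trans (↭-sym (columnReading-↭-entries T)) (↭-map⁻ toOdd-injective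
    (subst (_↭ odds n) (columnReading-map toOdd T) (reducedWord-sigma⇒↭odds n reduced)))

rowsOf-suc : ∀ B k → rowsOf B (suc k) ≡ idPerm B ⊗ rowsOf B k
rowsOf-suc B k = concatMap-map-∷ (idPerm B) (rowsOf B k)

fillingsUpTo-∷ : ∀ B k μ → fillingsUpTo B (k ∷ μ) ≡ rowsOf B k ⊗ fillingsUpTo B μ
fillingsUpTo-∷ B k μ = concatMap-map-∷ (rowsOf B k) (fillingsUpTo B μ)

rowsOf-length : ∀ B k → All (λ r → length r ≡ k) (rowsOf B k)
rowsOf-length B zero = refl ∷ []
rowsOf-length B (suc k) = subst (All _) (sym (rowsOf-suc B k))
  (AllP.cartesianProductWith⁺ (setoid ℕ) (setoid (List ℕ)) List._∷_ (idPerm B) (rowsOf B k)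
    (λ _ r∈ → cong suc (All.lookup (rowsOf-length B k) r∈)))

fillingsUpTo-shape : ∀ B μ → All (HasShape μ) (fillingsUpTo B μ)
fillingsUpTo-shape B [] = refl ∷ []
fillingsUpTo-shape B (k ∷ μ) = subst (All _) (sym (fillingsUpTo-∷ B k μ))
  (AllP.cartesianProductWith⁺ (setoid (List ℕ)) (setoid Filling) List._∷_ (rowsOf B k) (fillingsUpTo B μ)
    (λ r∈ T∈ → cong₂ _∷_ (All.lookup (rowsOf-length B k) r∈) (All.lookup (fillingsUpTo-shape B μ) T∈)))

filter-odd-rowsOf : ∀ B k → filter (All.all? Odd?) (rowsOf B k) ≡ map (map toOdd) (rowsOf ⌈ B /2⌉ k)
filter-odd-rowsOf B zero = refl
filter-odd-rowsOf B (suc k) = begin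
  filter (All.all? Odd?) (rowsOf B (suc k))
    ≡⟨ cong (filter (All.all? Odd?)) (rowsOf-suc B k) ⟩
  filter (All.all? Odd?) (idPerm B ⊗ rowsOf B k)
    ≡⟨ filter-all-⊗ Odd? (idPerm B) (rowsOf B k) ⟩
  filter Odd? (idPerm B) ⊗ filter (All.all? Odd?) (rowsOf B k)
    ≡⟨ cong₂ _⊗_ (filter-odd-idPerm B) (filter-odd-rowsOf B k) ⟩
  odds ⌈ B /2⌉ ⊗ map (map toOdd) (rowsOf ⌈ B /2⌉ k)
    ≡⟨ map-⊗ toOdd (idPerm ⌈ B /2⌉) (rowsOf ⌈ B /2⌉ k) ⟨
  map (map toOdd) (idPerm ⌈ B /2⌉ ⊗ rowsOf ⌈ B /2⌉ k)
    ≡⟨ cong (map (map toOdd)) (rowsOf-suc ⌈ B /2⌉ k) ⟨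
  map (map toOdd) (rowsOf ⌈ B /2⌉ (suc k)) ∎
  where open ≡-Reasoning

filter-odd-fillingsUpTo : ∀ B μ →
  filter (All.all? (All.all? Odd?)) (fillingsUpTo B μ) ≡ map (map (map toOdd)) (fillingsUpTo ⌈ B /2⌉ μ)
filter-odd-fillingsUpTo B [] = refl
filter-odd-fillingsUpTo B (k ∷ μ) = begin
  filter allOdd? (fillingsUpTo B (k ∷ μ))
    ≡⟨ cong (filter allOdd?) (fillingsUpTo-∷ B k μ) ⟩
  filter allOdd? (rowsOf B k ⊗ fillingsUpTo B μ)
    ≡⟨ filter-all-⊗ (All.all? Odd?) (rowsOf B k) _ ⟩
  filter (All.all? Odd?) (rowsOf B k) ⊗ filter allOdd? (fillingsUpTo B μ)
    ≡⟨ cong₂ _⊗_ (filter-odd-rowsOf B k) (filter-odd-fillingsUpTo B μ) ⟩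
  map (map toOdd) (rowsOf B′ k) ⊗ map (map (map toOdd)) (fillingsUpTo B′ μ)
    ≡⟨ map-⊗ (map toOdd) (rowsOf B′ k) (fillingsUpTo B′ μ) ⟨
  map (map (map toOdd)) (rowsOf B′ k ⊗ fillingsUpTo B′ μ)
    ≡⟨ cong (map (map (map toOdd))) (fillingsUpTo-∷ B′ k μ) ⟨
  map (map (map toOdd)) (fillingsUpTo B′ (k ∷ μ)) ∎
  where
  open ≡-Reasoning
  allOdd? = All.all? (All.all? Odd?)
  B′ = ⌈ B /2⌉

length-filter-odd-fillings : ∀ {R : Filling → Set} (R? : Decidable R) → (∀ {T} → R T → All (All Odd) T) → ∀ B μ →
  length (filter R? (fillingsUpTo B μ)) ≡ length (filter (R? ∘ map (map toOdd)) (fillingsUpTo ⌈ B /2⌉ μ))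
length-filter-odd-fillings R? R⇒odd B μ = begin
  length (filter R? (fillingsUpTo B μ))
    ≡⟨ cong length (filter-filter R? allOdd? R⇒odd (fillingsUpTo B μ)) ⟨
  length (filter R? (filter allOdd? (fillingsUpTo B μ)))
    ≡⟨ cong (length ∘ filter R?) (filter-odd-fillingsUpTo B μ) ⟩
  length (filter R? (map G Ts))
    ≡⟨ cong length (filter-map R? G Ts) ⟩
  length (map G (filter (R? ∘ G) Ts))
    ≡⟨ length-map G (filter (R? ∘ G) Ts) ⟩
  length (filter (R? ∘ G) Ts) ∎
  where
  open ≡-Reasoning
  allOdd? = All.all? (All.all? Odd?)
  G = map (map toOdd)
  Ts = fillingsUpTo ⌈ B /2⌉ μ

⌈n+n∸1/2⌉≡n : ∀ n → ⌈ n + n ∸ 1 /2⌉ ≡ n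
⌈n+n∸1/2⌉≡n zero = refl
⌈n+n∸1/2⌉≡n (suc n) = sym (n≡⌊n+n/2⌋ (suc n))

proposition3p10 : (n : ℕ) (μ : List ℕ) → IsPartition n μ → a (sigma n) μ ≡ f μ
proposition3p10 n μ (refl , _) = begin
  a (sigma n) μ
    ≡⟨ cong (λ m → length (filter rw? (fillingsUpTo (m ∸ 1) μ))) (length-sigma n) ⟩
  length (filter rw? (fillingsUpTo (n + n ∸ 1) μ))
    ≡⟨ length-filter-odd-fillings rw? (rwFilling-sigma⇒odd n) (n + n ∸ 1) μ ⟩
  length (filter (rw? ∘ map (map toOdd)) (fillingsUpTo ⌈ n + n ∸ 1 /2⌉ μ))
    ≡⟨ cong (λ m → length (filter (rw? ∘ map (map toOdd)) (fillingsUpTo m μ))) (⌈n+n∸1/2⌉≡n n) ⟩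
  length (filter (rw? ∘ map (map toOdd)) (fillingsUpTo n μ))
    ≡⟨ cong length (filter-cong-local (rw? ∘ map (map toOdd)) (isSYT? μ)
         (All.map (isRWFilling-sigma⇔isSYT μ) (fillingsUpTo-shape n μ))) ⟩
  f μ ∎
  where
  open ≡-Reasoning
  rw? = isRWFilling? (sigma n)
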